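{- Let $\Gamma$ be a basis and let $\mathcal M^\Gamma=\langle D,\{A^\sigma\}_\sigma,\cdot,\mathbf s,\mathbf k,\mathbf i\rangle$ with $D=\{[M]\mid M\in CL\}$, $A^\sigma=\{[M]\mid M\in CL\text{ and }\Gamma\vdash_{CL^=}M:\sigma\}$, $[M]\cdot[N]=[MN]$, $\mathbf s=[\mathsf S]$, $\mathbf k=[\mathsf K]$, $\mathbf i=[\mathsf I]$, and let $\rho^\star$ be the environment $\rho^\star(x)=[x]$. Then for every $CL$-term $M$ and simple type $\sigma$: $\mathcal M^\Gamma_{\rho^\star}\models M:\sigma$ if and only if $\Gamma\vdash_{CL^=}M:\sigma$.
   Context: $CL$ is the set of terms $M,N ::= x \mid \mathsf{S} \mid \mathsf{K} \mid \mathsf{I} \mid MN$ over a countable set $V$ of term variables. The equational theory $\mathcal{EQ}^\eta$ has axioms $M=M$, $\mathsf S MNL=(ML)(NL)$, $\mathsf K MN=M$, $\mathsf I M=M$ and rules: symmetry, transitivity, from $M=N$ infer $MP=NP$ and $PM=PN$, and from $Mx=Nx$ with $x$ not occurring in $M$ or $N$ infer $M=N$; $[M]$ is the equivalence class of $M$ under provable equality in $\mathcal{EQ}^\eta$. Simple types $\sigma ::= a\mid\sigma\to\tau$. A basis is a set of declarations $x:\sigma$ with pairwise distinct variables. The system $CL_\rightarrow^=$ derives $\Gamma\vdash_{CL^=}M:\sigma$ by: $x:\sigma$ if $x:\sigma\in\Gamma$; $\mathsf S:(\sigma\to(\rho\to\tau))\to((\sigma\to\rho)\to(\sigma\to\tau))$;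 $\mathsf K:\sigma\to(\tau\to\sigma)$; $\mathsf I:\sigma\to\sigma$ (all types); from $M:\sigma\to\tau$ and $N:\sigma$ infer $MN:\tau$; and (eq): from $\Gamma\vdash_{CL^=}M:\sigma$ and $M=N$ provable in $\mathcal{EQ}^\eta$ infer $\Gamma\vdash_{CL^=}N:\sigma$. (The tuple $\mathcal M^\Gamma$ is an applicative structure: $D$ nonempty, $A^\sigma\subseteq D$, $\cdot$ a binary operation on $D$, with distinguished elements $\mathbf s,\mathbf k,\mathbf i$.) Given an environment $\rho:V\to D$, interpretation of terms is $[\![x]\!]_\rho=\rho(x)$, $[\![\mathsf S]\!]_\rho=\mathbf s$, $[\![\mathsf K]\!]_\rho=\mathbf k$, $[\![\mathsf I]\!]_\rho=\mathbf i$, $[\![MN]\!]_\rho=[\![M]\!]_\rho\cdot[\![N]\!]_\rho$, and $\mathcal M^\Gamma_\rho\models M:\sigma$ means $[\![M]\!]_\rho\in A^\sigma$. -}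

module Defs where

open import Data.Nat using (ℕ)
open import Data.Maybe using (Maybe; just)
open import Data.Product using (Σ; _×_; _,_)
open import Relation.Binary.PropositionalEquality using (_≡_)
open import Relation.Nullary using (¬_)

Var : Set
Var = ℕ

infixl 9 _·_
data Term : Set where
  var : Var → Term
  S K I : Term
  _·_ : Term → Term → Term

data Occurs (x : Var) : Term → Set where
  here : Occurs x (var x)
  left : ∀ {M N} → Occurs x M → Occurs x (M · N)
  right : ∀ {M N} → Occurs x N → Occurs x (M · N)

infix 4 _=η_
data _=η_ : Term → Term → Set where
  refl= : ∀ {M} → M =η M
  S-ax : ∀ {M N L} → S · M · N · L =η (M · L) · (N · L)
  K-ax : ∀ {M N} → K · M · N =η M
  I-ax : ∀ {M} → I · M =η M
  sym= : ∀ {M N} → M =η N → N =η M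
  trans= : ∀ {M N L} → M =η N → N =η L → M =η L
  appL : ∀ {M N} P → M =η N → M · P =η N · P
  appR : ∀ {M N} P → M =η N → P · M =η P · N
  ext : ∀ {M N} x → ¬ Occurs x M → ¬ Occurs x N →
        M · var x =η N · var x → M =η N

infixr 5 _⇒_
data Type : Set where
  atom : ℕ → Type
  _⇒_ : Type → Type → Type

-- A basis: a set of declarations x : σ with pairwise distinct variables,
-- represented as a partial map from variables to types
-- (x : σ ∈ Γ  iff  Γ x ≡ just σ).
Basis : Set
Basis = Var → Maybe Type

infix 3 _⊢_∶_
data _⊢_∶_ (Γ : Basis) : Term → Type → Set where
  ax-var : ∀ {x σ} → Γ x ≡ just σ → Γ ⊢ var x ∶ σ
  ax-S : ∀ {σ ρ τ} → Γ ⊢ S ∶ (σ ⇒ (ρ ⇒ τ)) ⇒ ((σ ⇒ ρ) ⇒ (σ ⇒ τ))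
  ax-K : ∀ {σ τ} → Γ ⊢ K ∶ σ ⇒ (τ ⇒ σ)
  ax-I : ∀ {σ} → Γ ⊢ I ∶ σ ⇒ σ
  app : ∀ {M N σ τ} → Γ ⊢ M ∶ σ ⇒ τ → Γ ⊢ N ∶ σ → Γ ⊢ M · N ∶ τ
  eq : ∀ {M N σ} → Γ ⊢ M ∶ σ → M =η N → Γ ⊢ N ∶ σ

-- Applicative structures ⟨D, {A^σ}, ·, s, k, i⟩.  Since Agda has no
-- quotient types, the carrier D comes with an equality _≈_ (a setoid);
-- A^σ is a predicate on D.
record ApplicativeStructure : Set₁ where
  field
    D : Set
    _≈_ : D → D → Set
    A : Type → D → Set
    _∙_ : D → D → D
    s k i : D

module _ (𝓜 : ApplicativeStructure) where
  open ApplicativeStructure 𝓜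

  Env : Set
  Env = Var → D

  ⟦_⟧_ : Term → Env → D
  ⟦ var x ⟧ ρ = ρ x
  ⟦ S ⟧ ρ = s
  ⟦ K ⟧ ρ = k
  ⟦ I ⟧ ρ = i
  ⟦ M · N ⟧ ρ = (⟦ M ⟧ ρ) ∙ (⟦ N ⟧ ρ)

  infix 3 _⊨_∶_
  _⊨_∶_ : Env → Term → Type → Set
  ρ ⊨ M ∶ σ = A σ (⟦ M ⟧ ρ)

-- The term model 𝓜^Γ: D = CL / =η, represented as Term with equality =η;
-- [d] ∈ A^σ iff [d] = [M] for some M with Γ ⊢ M : σ;
-- [M]·[N] = [MN], s = [S], k = [K], i = [I].
termModel : Basis → ApplicativeStructure
termModel Γ = record
  { D = Term
  ; _≈_ = _=η_
  ; A = λ σ d → Σ Term (λ M → (d =η M) × (Γ ⊢ M ∶ σ))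
  ; _∙_ = _·_
  ; s = S
  ; k = K
  ; i = I
  }

ρ⋆ : (Γ : Basis) → Env (termModel Γ)
ρ⋆ Γ x = var x

module Submission where

open import Defs
open import Function.Bundles using (_⇔_; mk⇔)
open import Data.Product using (_,_)
open import Relation.Binary.PropositionalEquality using (_≡_; refl; sym; cong₂; subst)

⟦⟧-ρ⋆ : (Γ : Basis) (M : Term) → ⟦_⟧_ (termModel Γ) M (ρ⋆ Γ) ≡ M
⟦⟧-ρ⋆ Γ (var x) = refl
⟦⟧-ρ⋆ Γ S = refl
⟦⟧-ρ⋆ Γ K = refl
⟦⟧-ρ⋆ Γ I = refl
⟦⟧-ρ⋆ Γ (M · N) = cong₂ _·_ (⟦⟧-ρ⋆ Γ M) (⟦⟧-ρ⋆ Γ N)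

-- Because of rule (eq), the typed terms are already closed under =η,
-- so each A^σ of the term model is exactly the set of terms typable with σ.
termModel-A⇔⊢ : (Γ : Basis) (σ : Type) (M : Term) →
  ApplicativeStructure.A (termModel Γ) σ M ⇔ (Γ ⊢ M ∶ σ)
termModel-A⇔⊢ Γ σ M = mk⇔ (λ { (N , M=N , ⊢N) → eq ⊢N (sym= M=N) })
                          (λ ⊢M → M , refl= , ⊢M)

mainTheorem17 : (Γ : Basis) (M : Term) (σ : Type) →
    (_⊨_∶_ (termModel Γ) (ρ⋆ Γ) M σ) ⇔ (Γ ⊢ M ∶ σ)
mainTheorem17 Γ M σ =
  subst (λ d → ApplicativeStructure.A (termModel Γ) σ d ⇔ (Γ ⊢ M ∶ σ))
        (sym (⟦⟧-ρ⋆ Γ M)) (termModel-A⇔⊢ Γ σ M)
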